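{- Suppose that $N$ is an odd perfect number (i.e. $\sigma(N)=2N$), let $p_4$ be the fourth smallest prime factor of $N$, and let $k$ be the number of distinct prime factors of $N$. Then $$k \geq b_{\frac{256}{255}}(p_4) +3.$$
   Context: $\sigma(N)$ is the sum of the positive divisors of $N$. Let $P_j$ denote the $j$-th prime number. For a prime $P_j$ and a real number $\alpha>1$, $b_\alpha(P_j)$ is the smallest positive integer $b$ such that $$\alpha < \prod_{i=0}^{b-1}\frac{P_{j+i}}{P_{j+i}-1}.$$ -}

module Defs where

open import Data.Nat using (ℕ; zero; suc; _+_; _*_; _<_; _≤_)
open import Data.Nat.Divisibility using (_∣_; _∣?_)
open import Data.Nat.Primality using (Prime; prime?)
open import Data.Nat.ListAction using (sum)
open import Data.List using (List; filter; map; upTo; length; head; drop)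
open import Data.Maybe using (Maybe; just)
open import Relation.Binary.PropositionalEquality using (_≡_)
open import Data.Product using (_×_)
open import Relation.Nullary using (¬_)
open import Relation.Nullary.Decidable using (_×-dec_)
open import Data.Integer using (+_)
import Data.Rational as ℚ
open ℚ using (ℚ; 1ℚ; 0ℚ)

σ : ℕ → ℕ
σ N = sum (filter (_∣? N) (map suc (upTo N)))

primeFactors : ℕ → List ℕ
primeFactors N = filter (λ p → prime? p ×-dec p ∣? N) (upTo (suc N))

ω : ℕ → ℕ
ω N = length (primeFactors N)

FourthSmallestPrimeFactor : ℕ → ℕ → Set
FourthSmallestPrimeFactor N p = head (drop 3 (primeFactors N)) ≡ just p

NextPrime : ℕ → ℕ → Set
NextPrime q r = Prime r × q < r × (∀ m → q < m → m < r → ¬ Prime m)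

-- The rational p/(p-1) for p ≥ 2 (all primes); junk value 0 for p < 2.
ratio : ℕ → ℚ
ratio (suc (suc m)) = (+ suc (suc m)) ℚ./ suc m
ratio _ = 0ℚ

prodRatio : (ℕ → ℕ) → ℕ → ℚ
prodRatio ps zero = 1ℚ
prodRatio ps (suc b) = prodRatio ps b ℚ.* ratio (ps b)

-- Given ps with ps i = P_{j+i} (consecutive primes starting at P_j),
-- b is b_α(P_j): the smallest positive integer with α < ∏_{i<b} ps(i)/(ps(i)-1).
IsB : ℚ → (ℕ → ℕ) → ℕ → Set
IsB α ps b = 1 ≤ b × α ℚ.< prodRatio ps b
           × (∀ b′ → 1 ≤ b′ → b′ < b → ¬ (α ℚ.< prodRatio ps b′))

-- Write N = q₁^a₁ q₂^a₂ q₃^a₃ m with q₁ < q₂ < q₃ the three smallest prime factors, so that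
-- 2 = σ(N)/N = ∏ᵢ σ(qᵢ^aᵢ)/qᵢ^aᵢ · σ(m)/m. Since m > 1 the first product is below 2, and a case
-- analysis on the three smallest odd primes and their exponents bounds it by 255/128 = (3/2)(5/4)(17/16);
-- hence σ(m)/m ≥ 256/255. On the other hand σ(m)/m < ∏_{p ∣ m} p/(p − 1), and the k − 3 primes dividing m
-- are, in increasing order, at least the consecutive primes from p₄ on. So the product of p/(p − 1) over
-- the k − 3 consecutive primes from p₄ exceeds 256/255, that is b ≤ k − 3.
module Submission where

open import Defs
import Algebra.Properties.CommutativeSemigroup as CommSemigroupProperties
open import Data.Bool using (T)
open import Data.Empty using (⊥; ⊥-elim)
open import Data.Integer as ℤ using (+_; +<+)
import Data.Integer.Properties as ℤ
open import Data.List using (List; []; _∷_; filter; map; upTo; applyUpTo; _∷ʳ_; length)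
open import Data.List.Properties using (applyUpTo-∷ʳ; map-++)
open import Data.List.Membership.Propositional using (_∈_)
open import Data.List.Membership.Propositional.Properties
  using (∈-filter⁺; ∈-filter⁻; ∈-map⁺; ∈-map⁻; ∈-upTo⁺)
open import Data.List.Membership.Propositional.Properties.WithK using (unique∧set⇒bag)
open import Data.List.Relation.Binary.BagAndSetEquality using (∼bag⇒↭)
open import Data.List.Relation.Binary.Pointwise using (Pointwise; []; _∷_)
open import Data.List.Relation.Unary.All as All using (All; []; _∷_)
import Data.List.Relation.Unary.All.Properties as All
open import Data.List.Relation.Unary.AllPairs using (AllPairs; []; _∷_)
import Data.List.Relation.Unary.AllPairs.Properties as AllPairs
open import Data.List.Relation.Unary.Any using (here; there)
open import Data.List.Relation.Unary.Unique.Propositional using (Unique)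
import Data.List.Relation.Unary.Unique.Propositional.Properties as Unique
open import Data.Nat hiding (_/_)
open import Data.Nat.Coprimality using (Coprime; coprime-divisor)
open import Data.Nat.Divisibility
open import Data.Nat.Induction using (<-wellFounded)
open import Data.Nat.ListAction using (sum; product)
open import Data.Nat.ListAction.Properties using (sum-↭; product-++)
open import Data.Nat.Primality
open import Data.Nat.Primality.Factorisation using (factorise)
open import Data.Nat.Properties
open import Data.Nat.Tactic.RingSolver using (solve-∀)
open import Data.Product using (_×_; _,_; proj₁; proj₂; Σ-syntax; ∃-syntax)
import Data.Rational as ℚ
import Data.Rational.Properties as ℚ
open import Data.Rational using (_/_; toℚᵘ)
open import Data.Rational.Unnormalised using (ℚᵘ; mkℚᵘ; *<*)
import Data.Rational.Unnormalised as ℚᵘ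
import Data.Rational.Unnormalised.Properties as ℚᵘ
open import Data.Sum using (_⊎_; inj₁; inj₂)
open import Function using (_∘_; id)
open import Function.Bundles using (_⇔_; mk⇔; module Equivalence)
open import Induction.WellFounded using (Acc; acc)
open import Relation.Binary.PropositionalEquality
open import Relation.Nullary using (¬_; Dec; yes; no)
open import Relation.Nullary.Decidable using (¬?; from-yes; _→-dec_; _⊎-dec_; _×-dec_)

open Equivalence using (to; from)

private
  module +-CS = CommSemigroupProperties +-commutativeSemigroup
  module *-CS = CommSemigroupProperties *-commutativeSemigroup

-- Fractions

-- A pair (a , b) stands for the fraction a / b, compared by cross-multiplication;
-- transitivity needs a nonzero denominator in the middle.
Frac : Set
Frac = ℕ × ℕ

infix 4 _≼_ _≺_
infixl 7 _⊗_

record _≼_ (x y : Frac) : Set where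
  constructor mk≼
  field un≼ : proj₁ x * proj₂ y ≤ proj₁ y * proj₂ x

record _≺_ (x y : Frac) : Set where
  constructor mk≺
  field un≺ : proj₁ x * proj₂ y < proj₁ y * proj₂ x

_⊗_ : Frac → Frac → Frac
(a , b) ⊗ (c , d) = (a * c , b * d)

⊗-assoc : ∀ x y z → x ⊗ (y ⊗ z) ≡ x ⊗ y ⊗ z
⊗-assoc (a , b) (c , d) (e , f) = sym (cong₂ _,_ (*-assoc a c e) (*-assoc b d f))

≼-refl : ∀ {x} → x ≼ x
≼-refl = mk≼ ≤-refl

≼-compute : ∀ {x y} → {T (proj₁ x * proj₂ y ≤ᵇ proj₁ y * proj₂ x)} → x ≼ y
≼-compute {a , b} {c , d} {t} = mk≼ (≤ᵇ⇒≤ (a * d) (c * b) t)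

≼-trans : ∀ {x y z} → .{{NonZero (proj₂ y)}} → x ≼ y → y ≼ z → x ≼ z
≼-trans {a , b} {c , d} {e , f} (mk≼ ad≤cb) (mk≼ cf≤ed) = mk≼ (*-cancelʳ-≤ (a * f) (e * b) d (begin
  a * f * d   ≡⟨ *-CS.xy∙z≈xz∙y a d f ⟨
  a * d * f   ≤⟨ *-monoˡ-≤ f ad≤cb ⟩
  c * b * f   ≡⟨ *-CS.xy∙z≈xz∙y c b f ⟩
  c * f * b   ≤⟨ *-monoˡ-≤ b cf≤ed ⟩
  e * d * b   ≡⟨ *-CS.xy∙z≈xz∙y e d b ⟩
  e * b * d   ∎))
  where open ≤-Reasoning

≺-≼-trans : ∀ {x y z} → .{{NonZero (proj₂ y)}} → .{{NonZero (proj₂ z)}} → x ≺ y → y ≼ z → x ≺ z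
≺-≼-trans {a , b} {c , d} {e , f} (mk≺ ad<cb) (mk≼ cf≤ed) = mk≺ (*-cancelʳ-< d (a * f) (e * b) (begin-strict
  a * f * d   ≡⟨ *-CS.xy∙z≈xz∙y a d f ⟨
  a * d * f   <⟨ *-monoˡ-< f ad<cb ⟩
  c * b * f   ≡⟨ *-CS.xy∙z≈xz∙y c b f ⟩
  c * f * b   ≤⟨ *-monoˡ-≤ b cf≤ed ⟩
  e * d * b   ≡⟨ *-CS.xy∙z≈xz∙y e d b ⟩
  e * b * d   ∎))
  where open ≤-Reasoning

⊗-mono-≼ : ∀ {x x′ y y′} → x ≼ x′ → y ≼ y′ → x ⊗ y ≼ x′ ⊗ y′
⊗-mono-≼ {a , b} {a′ , b′} {c , d} {c′ , d′} (mk≼ ab′≤a′b) (mk≼ cd′≤c′d) =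
  mk≼ (subst₂ _≤_ (*-CS.interchange a b′ c d′) (*-CS.interchange a′ b c′ d) (*-mono-≤ ab′≤a′b cd′≤c′d))

≺⇒≼ : ∀ {x y} → x ≺ y → x ≼ y
≺⇒≼ (mk≺ x<y) = mk≼ (<⇒≤ x<y)

⊗-mono-≺-≼ : ∀ {x x′ y y′} → .{{NonZero (proj₁ y′ * proj₂ y)}} → x ≺ x′ → y ≼ y′ → x ⊗ y ≺ x′ ⊗ y′
⊗-mono-≺-≼ {a , b} {a′ , b′} {c , d} {c′ , d′} (mk≺ ab′<a′b) (mk≼ cd′≤c′d) = mk≺ (begin-strict
  a * c * (b′ * d′)    ≡⟨ *-CS.interchange a c b′ d′ ⟩
  a * b′ * (c * d′)    ≤⟨ *-monoʳ-≤ (a * b′) cd′≤c′d ⟩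
  a * b′ * (c′ * d)    <⟨ *-monoˡ-< (c′ * d) ab′<a′b ⟩
  a′ * b * (c′ * d)    ≡⟨ *-CS.interchange a′ b c′ d ⟩
  a′ * c′ * (b * d)    ∎)
  where open ≤-Reasoning

-- Divisor sums

divisors : ℕ → List ℕ
divisors n = filter (_∣? n) (map suc (upTo n))

divisors-unique : ∀ n → Unique (divisors n)
divisors-unique n = AllPairs.filter⁺ (_∣? n) (Unique.map⁺ suc-injective (Unique.upTo⁺ n))

∈-divisors⁻ : ∀ {n d} → d ∈ divisors n → d ∣ n
∈-divisors⁻ {n} d∈ = proj₂ (∈-filter⁻ (_∣? n) {xs = map suc (upTo n)} d∈)

∈-divisors⁺ : ∀ {n d} → .{{NonZero n}} → d ∣ n → d ∈ divisors n
∈-divisors⁺ {n} {zero}  0∣n = ⊥-elim (≢-nonZero⁻¹ n (0∣⇒≡0 0∣n))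
∈-divisors⁺ {n} {suc d} d∣n = ∈-filter⁺ (_∣? n) (∈-map⁺ suc (∈-upTo⁺ (∣⇒≤ d∣n))) d∣n

sum-unique-≡ : {xs ys : List ℕ} → Unique xs → Unique ys →
  (∀ {x} → x ∈ xs → x ∈ ys) → (∀ {x} → x ∈ ys → x ∈ xs) → sum xs ≡ sum ys
sum-unique-≡ uxs uys xs⊆ys ys⊆xs = sum-↭ (∼bag⇒↭ (unique∧set⇒bag uxs uys (mk⇔ xs⊆ys ys⊆xs)))

sum-partition : ∀ {P : ℕ → Set} (P? : ∀ x → Dec (P x)) xs →
  sum xs ≡ sum (filter P? xs) + sum (filter (¬? ∘ P?) xs)
sum-partition P? [] = refl
sum-partition P? (x ∷ xs) with P? x
... | yes _ = trans (cong (_+_ x) (sum-partition P? xs)) (sym (+-assoc x _ _))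
... | no _  = trans (cong (_+_ x) (sum-partition P? xs)) (+-CS.x∙yz≈y∙xz x (sum (filter P? xs)) _)

geomSum : ℕ → ℕ → ℕ
geomSum q zero    = 1
geomSum q (suc a) = q * geomSum q a + 1

sum-map-* : ∀ q xs → sum (map (q *_) xs) ≡ q * sum xs
sum-map-* q []       = sym (*-zeroʳ q)
sum-map-* q (x ∷ xs) = trans (cong (_+_ (q * x)) (sum-map-* q xs)) (sym (*-distribˡ-+ q x _))

prime∤⇒coprime : ∀ {q d} → Prime q → ¬ q ∣ d → Coprime d q
prime∤⇒coprime q-prime q∤d (c∣d , c∣q) with prime⇒irreducible q-prime c∣q
... | inj₁ c≡1 = c≡1
... | inj₂ refl = ⊥-elim (q∤d c∣d)

∣-cancel-prime^ : ∀ {q d} r → Prime q → ¬ q ∣ d → ∀ a → d ∣ q ^ a * r → d ∣ r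
∣-cancel-prime^ {q} {d} r q-prime q∤d zero    d∣ = subst (d ∣_) (+-identityʳ r) d∣
∣-cancel-prime^ {q} {d} r q-prime q∤d (suc a) d∣ =
  ∣-cancel-prime^ r q-prime q∤d a
    (coprime-divisor (prime∤⇒coprime q-prime q∤d) (subst (d ∣_) (*-assoc q (q ^ a) r) d∣))

module _ {q r : ℕ} (q-prime : Prime q) (q∤r : ¬ q ∣ r) .{{_ : NonZero r}} where

  private
    instance q≢0 = prime⇒nonZero q-prime
    q^a*r≢0 : ∀ a → NonZero (q ^ a * r)
    q^a*r≢0 a = m*n≢0 (q ^ a) r {{m^n≢0 q a}}

  -- The divisors of q ^ (a + 1) * r divisible by q are q times the divisors of q ^ a * r;
  -- the others are the divisors of r.
  sum-divisors-∣ : ∀ a → sum (filter (q ∣?_) (divisors (q ^ suc a * r))) ≡ q * σ (q ^ a * r)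
  sum-divisors-∣ a = trans
    (sum-unique-≡ (AllPairs.filter⁺ (q ∣?_) (divisors-unique (q ^ suc a * r)))
                  (Unique.map⁺ (*-cancelˡ-≡ _ _ q) (divisors-unique M)) ⊆ ⊇)
    (sum-map-* q (divisors M))
    where
    M : ℕ
    M = q ^ a * r
    instance _ = q^a*r≢0 a ; _ = q^a*r≢0 (suc a)
    qM≡ : q ^ suc a * r ≡ q * M
    qM≡ = *-assoc q (q ^ a) r
    ⊆ : ∀ {x} → x ∈ filter (q ∣?_) (divisors (q ^ suc a * r)) → x ∈ map (q *_) (divisors M)
    ⊆ x∈ with ∈-filter⁻ (q ∣?_) {xs = divisors (q ^ suc a * r)} x∈
    ... | x∈divs , divides k refl = subst (_∈ map (q *_) (divisors M)) (*-comm q k)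
      (∈-map⁺ (q *_) (∈-divisors⁺ (*-cancelˡ-∣ q
        (subst₂ _∣_ (*-comm k q) qM≡ (∈-divisors⁻ x∈divs)))))
    ⊇ : ∀ {x} → x ∈ map (q *_) (divisors M) → x ∈ filter (q ∣?_) (divisors (q ^ suc a * r))
    ⊇ x∈ with ∈-map⁻ (q *_) x∈
    ... | y , y∈ , refl = ∈-filter⁺ (q ∣?_)
      (∈-divisors⁺ (subst (q * y ∣_) (sym qM≡) (*-monoʳ-∣ q (∈-divisors⁻ y∈)))) (m∣m*n y)

  sum-divisors-∤ : ∀ a → sum (filter (¬? ∘ (q ∣?_)) (divisors (q ^ a * r))) ≡ σ r
  sum-divisors-∤ a = sum-unique-≡ (AllPairs.filter⁺ (¬? ∘ (q ∣?_)) (divisors-unique (q ^ a * r)))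
                                  (divisors-unique r) ⊆ ⊇
    where
    instance _ = q^a*r≢0 a
    ⊆ : ∀ {x} → x ∈ filter (¬? ∘ (q ∣?_)) (divisors (q ^ a * r)) → x ∈ divisors r
    ⊆ x∈ with ∈-filter⁻ (¬? ∘ (q ∣?_)) {xs = divisors (q ^ a * r)} x∈
    ... | x∈divs , q∤x = ∈-divisors⁺ (∣-cancel-prime^ r q-prime q∤x a (∈-divisors⁻ x∈divs))
    ⊇ : ∀ {x} → x ∈ divisors r → x ∈ filter (¬? ∘ (q ∣?_)) (divisors (q ^ a * r))
    ⊇ x∈ = ∈-filter⁺ (¬? ∘ (q ∣?_)) (∈-divisors⁺ (∣n⇒∣m*n (q ^ a) (∈-divisors⁻ x∈)))
      (λ q∣x → q∤r (∣-trans q∣x (∈-divisors⁻ x∈)))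

  σ-prime^* : ∀ a → σ (q ^ a * r) ≡ geomSum q a * σ r
  σ-prime^* zero    = trans (cong σ (*-identityˡ r)) (sym (*-identityˡ (σ r)))
  σ-prime^* (suc a) = begin
    σ (q ^ suc a * r)                  ≡⟨ sum-partition (q ∣?_) (divisors (q ^ suc a * r)) ⟩
    sum (filter (q ∣?_) (divisors (q ^ suc a * r)))
      + sum (filter (¬? ∘ (q ∣?_)) (divisors (q ^ suc a * r)))
                                       ≡⟨ cong₂ _+_ (sum-divisors-∣ a) (sum-divisors-∤ (suc a)) ⟩
    q * σ (q ^ a * r) + σ r            ≡⟨ cong (λ t → q * t + σ r) (σ-prime^* a) ⟩
    q * (geomSum q a * σ r) + σ r      ≡⟨ cong₂ _+_ (*-assoc q (geomSum q a) (σ r)) (*-identityˡ (σ r)) ⟨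
    q * geomSum q a * σ r + 1 * σ r    ≡⟨ *-distribʳ-+ (σ r) (q * geomSum q a) 1 ⟨
    (q * geomSum q a + 1) * σ r        ∎
    where open ≡-Reasoning

-- Abundancy

ratioᶠ : ℕ → Frac
ratioᶠ q = (q , pred q)

∏ratioᶠ : List ℕ → Frac
∏ratioᶠ qs = (product qs , product (map pred qs))

geomRatio : ℕ → ℕ → Frac
geomRatio q a = (geomSum q a , q ^ a)

abundancy : ℕ → Frac
abundancy n = (σ n , n)

geomSum-telescope : ∀ d a → geomSum (suc d) a * d + 1 ≡ suc d ^ suc a
geomSum-telescope d zero    = base d
  where
  base : ∀ d → 1 * d + 1 ≡ suc d * 1
  base = solve-∀
geomSum-telescope d (suc a) = trans (shift d (geomSum (suc d) a)) (cong (suc d *_) (geomSum-telescope d a))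
  where
  shift : ∀ d g → (suc d * g + 1) * d + 1 ≡ suc d * (g * d + 1)
  shift = solve-∀

geomRatio≺ratioᶠ : ∀ q a → .{{NonZero q}} → geomRatio q a ≺ ratioᶠ q
geomRatio≺ratioᶠ (suc d) a = mk≺ (subst (geomSum (suc d) a * d <_) (geomSum-telescope d a) (m<m+n _ 0<1+n))

geomRatio-step : ∀ q a → geomRatio q a ≼ geomRatio q (suc a)
geomRatio-step q a = mk≼ (begin
  g * (q * q ^ a)         ≡⟨ *-CS.x∙yz≈y∙xz g q (q ^ a) ⟩
  q * (g * q ^ a)         ≡⟨ *-assoc q g (q ^ a) ⟨
  q * g * q ^ a           ≤⟨ m≤m+n _ _ ⟩
  q * g * q ^ a + q ^ a   ≡⟨ cong (_+_ (q * g * q ^ a)) (*-identityˡ (q ^ a)) ⟨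
  q * g * q ^ a + 1 * q ^ a ≡⟨ *-distribʳ-+ (q ^ a) (q * g) 1 ⟨
  (q * g + 1) * q ^ a     ∎)
  where
  open ≤-Reasoning
  g : ℕ
  g = geomSum q a

geomRatio-mono : ∀ q k a → .{{NonZero q}} → k ≤ a → geomRatio q k ≼ geomRatio q a
geomRatio-mono q k zero    z≤n = ≼-refl
geomRatio-mono q k (suc a) k≤1+a with m≤n⇒m<n∨m≡n k≤1+a
... | inj₂ refl   = ≼-refl
... | inj₁ k<1+a = ≼-trans {{m^n≢0 q a}} (geomRatio-mono q k a (≤-pred k<1+a)) (geomRatio-step q a)

ratioᶠ-antitone : ∀ {m n} → m ≤ n → ratioᶠ n ≼ ratioᶠ m
ratioᶠ-antitone {zero}  {n}     _  = mk≼ (≤-reflexive (*-zeroʳ n))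
ratioᶠ-antitone {suc m} {suc n} 1+m≤1+n = mk≼ (begin
  suc n * m   ≡⟨ *-comm (suc n) m ⟩
  m * suc n   ≡⟨ *-suc m n ⟩
  m + m * n   ≤⟨ +-monoˡ-≤ (m * n) (≤-pred 1+m≤1+n) ⟩
  n + m * n   ≡⟨ cong (_+_ n) (*-comm m n) ⟩
  n + n * m   ≡⟨ *-suc n m ⟨
  n * suc m   ≡⟨ *-comm n (suc m) ⟩
  suc m * n   ∎)
  where open ≤-Reasoning

∏ratioᶠ-antitone : ∀ {xs ys} → Pointwise _≤_ ys xs → ∏ratioᶠ xs ≼ ∏ratioᶠ ys
∏ratioᶠ-antitone []              = ≼-refl
∏ratioᶠ-antitone (y≤x ∷ ys≤xs) = ⊗-mono-≼ (ratioᶠ-antitone y≤x) (∏ratioᶠ-antitone ys≤xs)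

prime≥2 : ∀ {p} → Prime p → 2 ≤ p
prime≥2 {p} p-prime = nonTrivial⇒n>1 p {{prime⇒nonTrivial p-prime}}

prime∣prime⇒≡ : ∀ {p q} → Prime p → Prime q → p ∣ q → p ≡ q
prime∣prime⇒≡ p-prime q-prime p∣q with prime⇒irreducible q-prime p∣q
... | inj₁ refl = ⊥-elim (¬prime[1] p-prime)
... | inj₂ p≡q = p≡q

record Valuation (q n : ℕ) : Set where
  field
    exponent cofactor : ℕ
    n≡q^e*r : n ≡ q ^ suc exponent * cofactor
    q∤cofactor : ¬ q ∣ cofactor

valuation : ∀ {q n} → Prime q → .{{NonZero n}} → q ∣ n → Valuation q n
valuation {q} q-prime = go (<-wellFounded _)
  where
  go : ∀ {n} → Acc _<_ n → .{{NonZero n}} → q ∣ n → Valuation q n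
  go {n} (acc rec) (divides m n≡m*q) with q ∣? m
  ... | no q∤m = record
    { exponent = 0 ; cofactor = m ; q∤cofactor = q∤m
    ; n≡q^e*r = trans n≡m*q (trans (*-comm m q) (cong (_* m) (sym (*-identityʳ q)))) }
  ... | yes q∣m = record
    { exponent = suc exponent ; cofactor = cofactor ; q∤cofactor = q∤cofactor
    ; n≡q^e*r = begin
        n                                 ≡⟨ n≡m*q ⟩
        m * q                             ≡⟨ *-comm m q ⟩
        q * m                             ≡⟨ cong (q *_) n≡q^e*r ⟩
        q * (q ^ suc exponent * cofactor) ≡⟨ *-assoc q (q ^ suc exponent) cofactor ⟨
        q ^ suc (suc exponent) * cofactor ∎ }
    where
    open ≡-Reasoning
    instance m≢0 = ≢-nonZero λ m≡0 → ≢-nonZero⁻¹ n (trans n≡m*q (cong (_* q) m≡0))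
    m<n : m < n
    m<n = subst (m <_) (sym n≡m*q) (m<m*n m q (prime≥2 q-prime))
    open Valuation (go (rec m<n) q∣m)

module ValuationProperties {q n : ℕ} (q-prime : Prime q) .{{_ : NonZero n}} (v : Valuation q n) where
  open Valuation v public

  instance
    cofactor≢0 : NonZero cofactor
    cofactor≢0 = ≢-nonZero λ r≡0 → ≢-nonZero⁻¹ n
      (trans n≡q^e*r (trans (cong (q ^ suc exponent *_) r≡0) (*-zeroʳ (q ^ suc exponent))))

  cofactor∣n : cofactor ∣ n
  cofactor∣n = subst (cofactor ∣_) (sym n≡q^e*r) (n∣m*n (q ^ suc exponent))

  ∣cofactor : ∀ {p} → Prime p → p ≢ q → p ∣ n → p ∣ cofactor
  ∣cofactor p-prime p≢q p∣n = ∣-cancel-prime^ cofactor q-prime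
    (λ q∣p → p≢q (sym (prime∣prime⇒≡ q-prime p-prime q∣p))) (suc exponent) (subst (_ ∣_) n≡q^e*r p∣n)

  σ-valuation : σ n ≡ geomSum q (suc exponent) * σ cofactor
  σ-valuation = trans (cong σ n≡q^e*r) (σ-prime^* q-prime q∤cofactor (suc exponent))

  abundancy-valuation : abundancy n ≡ geomRatio q (suc exponent) ⊗ abundancy cofactor
  abundancy-valuation = cong₂ _,_ σ-valuation n≡q^e*r

m≤sum : ∀ {x xs} → x ∈ xs → x ≤ sum xs
m≤sum {xs = y ∷ ys} (here refl) = m≤m+n y (sum ys)
m≤sum {xs = y ∷ ys} (there x∈)  = ≤-trans (m≤sum x∈) (m≤n+m (sum ys) y)

n≤σ[n] : ∀ n → .{{NonZero n}} → n ≤ σ n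
n≤σ[n] n = m≤sum (∈-divisors⁺ {n} ∣-refl)

q^a≤geomSum : ∀ q a → q ^ a ≤ geomSum q a
q^a≤geomSum q zero    = ≤-refl
q^a≤geomSum q (suc a) = ≤-trans (*-monoʳ-≤ q (q^a≤geomSum q a)) (m≤m+n (q * geomSum q a) 1)

q^a<geomSum : ∀ q a → q ^ suc a < geomSum q (suc a)
q^a<geomSum q a = subst (q ^ suc a <_) (+-comm 1 (q * geomSum q a)) (s≤s (*-monoʳ-≤ q (q^a≤geomSum q a)))

prime∣⇒<σ : ∀ {p n} → Prime p → .{{NonZero n}} → p ∣ n → n < σ n
prime∣⇒<σ {p} {n} p-prime p∣n = begin-strict
  n                                      ≡⟨ n≡q^e*r ⟩
  p ^ suc exponent * cofactor            <⟨ m<m+n _ (>-nonZero⁻¹ cofactor) ⟩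
  p ^ suc exponent * cofactor + cofactor ≡⟨ +-comm _ cofactor ⟩
  suc (p ^ suc exponent) * cofactor      ≤⟨ *-monoˡ-≤ cofactor (q^a<geomSum p exponent) ⟩
  geomSum p (suc exponent) * cofactor    ≤⟨ *-monoʳ-≤ (geomSum p (suc exponent)) (n≤σ[n] cofactor) ⟩
  geomSum p (suc exponent) * σ cofactor  ≡⟨ σ-valuation ⟨
  σ n                                    ∎
  where
  open ≤-Reasoning
  open ValuationProperties p-prime (valuation p-prime p∣n)

PrimeFactorsIn : List ℕ → ℕ → Set
PrimeFactorsIn qs n = ∀ {p} → Prime p → p ∣ n → p ∈ qs

no-prime-factor⇒≡1 : ∀ n → .{{NonZero n}} → PrimeFactorsIn [] n → n ≡ 1
no-prime-factor⇒≡1 n ⊆[] with factorise n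
... | record { factors = [] ; isFactorisation = n≡1 } = n≡1
... | record { factors = p ∷ ps ; isFactorisation = n≡∏ ; factorsPrime = p-prime ∷ _ }
  with () ← ⊆[] p-prime (subst (p ∣_) (sym n≡∏) (m∣m*n (product ps)))

pred[prime]≢0 : ∀ {p} → Prime p → NonZero (pred p)
pred[prime]≢0 p-prime = >-nonZero (pred-mono-≤ (prime≥2 p-prime))

product-pred-primes≢0 : ∀ {qs} → All Prime qs → NonZero (product (map pred qs))
product-pred-primes≢0 []                   = _
product-pred-primes≢0 (q-prime ∷ qs-prime) =
  m*n≢0 _ _ {{pred[prime]≢0 q-prime}} {{product-pred-primes≢0 qs-prime}}

mutual
  abundancy≼∏ratioᶠ : ∀ qs n → .{{NonZero n}} → All Prime qs → PrimeFactorsIn qs n → abundancy n ≼ ∏ratioᶠ qs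
  abundancy≼∏ratioᶠ []       n _ ⊆[] with refl ← sym (no-prime-factor⇒≡1 n ⊆[]) = ≼-refl
  abundancy≼∏ratioᶠ (q ∷ qs) n qs-prime ⊆qs = ≺⇒≼ (abundancy≺∏ratioᶠ q qs n qs-prime ⊆qs)

  abundancy≺∏ratioᶠ : ∀ q qs n → .{{NonZero n}} → All Prime (q ∷ qs) → PrimeFactorsIn (q ∷ qs) n →
                     abundancy n ≺ ∏ratioᶠ (q ∷ qs)
  abundancy≺∏ratioᶠ q qs n (q-prime ∷ qs-prime) ⊆q∷qs with q ∣? n
  ... | no q∤n = -- n = q ^ 0 * n
    subst (_≺ ∏ratioᶠ (q ∷ qs)) (cong₂ _,_ (*-identityˡ (σ n)) (*-identityˡ n))
    (⊗-mono-≺-≼ {{∏qs*n≢0}} (geomRatio≺ratioᶠ q 0) (abundancy≼∏ratioᶠ qs n qs-prime ⊆qs))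
    where
    instance _ = prime⇒nonZero q-prime
    ∏qs*n≢0 = m*n≢0 (product qs) n {{productOfPrimes≢0 qs-prime}}
    ⊆qs : PrimeFactorsIn qs n
    ⊆qs p-prime p∣n with ⊆q∷qs p-prime p∣n
    ... | here refl  = ⊥-elim (q∤n p∣n)
    ... | there p∈qs = p∈qs
  ... | yes q∣n = subst (_≺ ∏ratioᶠ (q ∷ qs)) (sym abundancy-valuation)
    (⊗-mono-≺-≼ {{∏qs*r≢0}} (geomRatio≺ratioᶠ q (suc exponent)) (abundancy≼∏ratioᶠ qs cofactor qs-prime ⊆qs))
    where
    instance _ = prime⇒nonZero q-prime
    open ValuationProperties q-prime (valuation q-prime q∣n)
    ∏qs*r≢0 = m*n≢0 (product qs) cofactor {{productOfPrimes≢0 qs-prime}}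
    ⊆qs : PrimeFactorsIn qs cofactor
    ⊆qs p-prime p∣r with ⊆q∷qs p-prime (∣-trans p∣r cofactor∣n)
    ... | here refl  = ⊥-elim (q∤cofactor p∣r)
    ... | there p∈qs = p∈qs

-- The three smallest prime powers of an odd perfect number

geomRatio³ : ℕ → ℕ → ℕ → ℕ → ℕ → ℕ → Frac
geomRatio³ q₁ q₂ q₃ a₁ a₂ a₃ = geomRatio q₁ a₁ ⊗ geomRatio q₂ a₂ ⊗ geomRatio q₃ a₃

-- 255/128 = (3/2)(5/4)(17/16)
255/128 : Frac
255/128 = (255 , 128)

⊗³-mono-≼ : ∀ {x₁ x₂ x₃ y₁ y₂ y₃} → x₁ ≼ y₁ → x₂ ≼ y₂ → x₃ ≼ y₃ → x₁ ⊗ x₂ ⊗ x₃ ≼ y₁ ⊗ y₂ ⊗ y₃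
⊗³-mono-≼ x₁≼y₁ x₂≼y₂ x₃≼y₃ = ⊗-mono-≼ (⊗-mono-≼ x₁≼y₁ x₂≼y₂) x₃≼y₃

geomRatio≼ratioᶠ : ∀ q a → .{{NonZero q}} → geomRatio q a ≼ ratioᶠ q
geomRatio≼ratioᶠ q a = ≺⇒≼ (geomRatio≺ratioᶠ q a)

-- Either some exponents are small enough that bounding the other factors by q / (q - 1) keeps the
-- product below 255/128, or the exponents are large enough for it to reach 2.
geomRatio-3-5-7 : ∀ a₁ a₂ a₃ → ¬ (2 , 1) ≼ geomRatio³ 3 5 7 (1 + a₁) (1 + a₂) (2 + a₃) →
  geomRatio³ 3 5 7 (1 + a₁) (1 + a₂) (2 + a₃) ≼ 255/128
geomRatio-3-5-7 zero a₂ a₃ _ = ≼-trans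
  (⊗³-mono-≼ (≼-refl {geomRatio 3 1}) (geomRatio≼ratioᶠ 5 (1 + a₂)) (geomRatio≼ratioᶠ 7 (2 + a₃)))
  ≼-compute
geomRatio-3-5-7 (suc a₁) a₂ a₃ deficient = ⊥-elim (deficient (≼-trans ≼-compute
  (⊗³-mono-≼ (geomRatio-mono 3 2 (2 + a₁) (m≤m+n 2 a₁)) (geomRatio-mono 5 1 (1 + a₂) (m≤m+n 1 a₂))
             (geomRatio-mono 7 2 (2 + a₃) (m≤m+n 2 a₃)))))

geomRatio-3-5-11 : ∀ a₁ a₂ a₃ → ¬ (2 , 1) ≼ geomRatio³ 3 5 11 (1 + a₁) (1 + a₂) (2 + a₃) →
  geomRatio³ 3 5 11 (1 + a₁) (1 + a₂) (2 + a₃) ≼ 255/128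
geomRatio-3-5-11 zero a₂ a₃ _ = ≼-trans
  (⊗³-mono-≼ (≼-refl {geomRatio 3 1}) (geomRatio≼ratioᶠ 5 (1 + a₂)) (geomRatio≼ratioᶠ 11 (2 + a₃)))
  ≼-compute
geomRatio-3-5-11 (suc zero) a₂ a₃ _ = ≼-trans
  (⊗³-mono-≼ (≼-refl {geomRatio 3 2}) (geomRatio≼ratioᶠ 5 (1 + a₂)) (geomRatio≼ratioᶠ 11 (2 + a₃)))
  ≼-compute
geomRatio-3-5-11 (suc (suc a₁)) zero a₃ _ = ≼-trans
  (⊗³-mono-≼ (geomRatio≼ratioᶠ 3 (3 + a₁)) (≼-refl {geomRatio 5 1}) (geomRatio≼ratioᶠ 11 (2 + a₃)))
  ≼-compute
geomRatio-3-5-11 (suc (suc a₁)) (suc a₂) a₃ deficient = ⊥-elim (deficient (≼-trans ≼-compute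
  (⊗³-mono-≼ (geomRatio-mono 3 3 (3 + a₁) (m≤m+n 3 a₁)) (geomRatio-mono 5 2 (2 + a₂) (m≤m+n 2 a₂))
             (geomRatio-mono 11 2 (2 + a₃) (m≤m+n 2 a₃)))))

geomRatio-3-5-13 : ∀ a₁ a₂ a₃ → ¬ (2 , 1) ≼ geomRatio³ 3 5 13 (1 + a₁) (1 + a₂) (2 + a₃) →
  geomRatio³ 3 5 13 (1 + a₁) (1 + a₂) (2 + a₃) ≼ 255/128
geomRatio-3-5-13 zero a₂ a₃ _ = ≼-trans
  (⊗³-mono-≼ (≼-refl {geomRatio 3 1}) (geomRatio≼ratioᶠ 5 (1 + a₂)) (geomRatio≼ratioᶠ 13 (2 + a₃)))
  ≼-compute
geomRatio-3-5-13 (suc zero) a₂ a₃ _ = ≼-trans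
  (⊗³-mono-≼ (≼-refl {geomRatio 3 2}) (geomRatio≼ratioᶠ 5 (1 + a₂)) (geomRatio≼ratioᶠ 13 (2 + a₃)))
  ≼-compute
geomRatio-3-5-13 (suc (suc zero)) zero a₃ _ = ≼-trans
  (⊗³-mono-≼ (≼-refl {geomRatio 3 3}) (≼-refl {geomRatio 5 1}) (geomRatio≼ratioᶠ 13 (2 + a₃)))
  ≼-compute
geomRatio-3-5-13 (suc (suc zero)) (suc zero) a₃ _ = ≼-trans
  (⊗³-mono-≼ (≼-refl {geomRatio 3 3}) (≼-refl {geomRatio 5 2}) (geomRatio≼ratioᶠ 13 (2 + a₃)))
  ≼-compute
geomRatio-3-5-13 (suc (suc zero)) (suc (suc a₂)) a₃ deficient = ⊥-elim (deficient (≼-trans ≼-compute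
  (⊗³-mono-≼ (≼-refl {geomRatio 3 3}) (geomRatio-mono 5 3 (3 + a₂) (m≤m+n 3 a₂))
             (geomRatio-mono 13 2 (2 + a₃) (m≤m+n 2 a₃)))))
geomRatio-3-5-13 (suc (suc (suc a₁))) zero a₃ _ = ≼-trans
  (⊗³-mono-≼ (geomRatio≼ratioᶠ 3 (4 + a₁)) (≼-refl {geomRatio 5 1}) (geomRatio≼ratioᶠ 13 (2 + a₃)))
  ≼-compute
geomRatio-3-5-13 (suc (suc (suc a₁))) (suc a₂) a₃ deficient = ⊥-elim (deficient (≼-trans ≼-compute
  (⊗³-mono-≼ (geomRatio-mono 3 4 (4 + a₁) (m≤m+n 4 a₁)) (geomRatio-mono 5 2 (2 + a₂) (m≤m+n 2 a₂))
             (geomRatio-mono 13 2 (2 + a₃) (m≤m+n 2 a₃)))))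

geomRatio≼ratioᶠ-≤ : ∀ {c q} a → 2 ≤ q → c ≤ q → geomRatio q a ≼ ratioᶠ c
geomRatio≼ratioᶠ-≤ {q = suc (suc d)} a _ c≤q = ≼-trans (geomRatio≼ratioᶠ (2 + d) a) (ratioᶠ-antitone c≤q)
geomRatio≼ratioᶠ-≤ {q = 1}           a (s≤s ()) _

2∣n⊎2∣1+n : ∀ n → 2 ∣ n ⊎ 2 ∣ suc n
2∣n⊎2∣1+n zero    = inj₁ (divides 0 refl)
2∣n⊎2∣1+n (suc n) with 2∣n⊎2∣1+n n
... | inj₁ (divides k n≡k*2) = inj₂ (divides (suc k) (cong (_+_ 2) n≡k*2))
... | inj₂ 2∣1+n            = inj₁ 2∣1+n

odd<odd⇒2+≤ : ∀ {m n} → ¬ 2 ∣ m → ¬ 2 ∣ n → m < n → 2 + m ≤ n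
odd<odd⇒2+≤ {m} m-odd n-odd m<n with 2∣n⊎2∣1+n m
... | inj₁ 2∣m   = ⊥-elim (m-odd 2∣m)
... | inj₂ 2∣1+m = ≤∧≢⇒< m<n (λ 1+m≡n → n-odd (subst (2 ∣_) 1+m≡n 2∣1+m))

odd<5⇒≡3 : ∀ {q} → q < 5 → 2 ≤ q → ¬ 2 ∣ q → q ≡ 3
odd<5⇒≡3 = from-yes (allUpTo? (λ q → 2 ≤? q →-dec ¬? (2 ∣? q) →-dec q ≟ 3) 5)

odd<7⇒≡5 : ∀ {q} → q < 7 → 5 ≤ q → ¬ 2 ∣ q → q ≡ 5
odd<7⇒≡5 = from-yes (allUpTo? (λ q → 5 ≤? q →-dec ¬? (2 ∣? q) →-dec q ≟ 5) 7)

oddPrime<17⇒7,11,13 : ∀ {q} → q < 17 → 7 ≤ q → Prime q → ¬ 2 ∣ q → q ≡ 7 ⊎ q ≡ 11 ⊎ q ≡ 13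
oddPrime<17⇒7,11,13 = from-yes (allUpTo? (λ q →
  7 ≤? q →-dec prime? q →-dec ¬? (2 ∣? q) →-dec (q ≟ 7 ⊎-dec q ≟ 11 ⊎-dec q ≟ 13)) 17)
-- Bounding every factor by q / (q - 1) settles all cases but q₁ = 3, q₂ = 5, q₃ ∈ {7, 11, 13}.
geomRatio³≼255/128 : ∀ {N q₁ q₂ q₃} a₁ a₂ a₃ →
  Prime q₁ → Prime q₂ → Prime q₃ → ¬ 2 ∣ q₁ → ¬ 2 ∣ q₂ → ¬ 2 ∣ q₃ → q₁ < q₂ → q₂ < q₃ →
  ¬ 2 ∣ N → geomSum q₃ (suc a₃) ∣ 2 * N → (∀ {p} → Prime p → p ∣ N → q₂ < p → p < q₃ → ⊥) →
  ¬ (2 , 1) ≼ geomRatio³ q₁ q₂ q₃ (suc a₁) (suc a₂) (suc a₃) →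
  geomRatio³ q₁ q₂ q₃ (suc a₁) (suc a₂) (suc a₃) ≼ 255/128
geomRatio³≼255/128 {N} {q₁} {q₂} {q₃} a₁ a₂ a₃ q₁-prime q₂-prime q₃-prime q₁-odd q₂-odd q₃-odd q₁<q₂ q₂<q₃
  N-odd σ[q₃^a₃]∣2N no-prime-between deficient
  with 5 ≤? q₁
... | yes 5≤q₁ = ≼-trans {y = ratioᶠ 5 ⊗ ratioᶠ 7 ⊗ ratioᶠ 9}
  (⊗³-mono-≼ (geomRatio≼ratioᶠ-≤ (suc a₁) (prime≥2 q₁-prime) 5≤q₁)
             (geomRatio≼ratioᶠ-≤ (suc a₂) (prime≥2 q₂-prime) 7≤q₂)
             (geomRatio≼ratioᶠ-≤ (suc a₃) (prime≥2 q₃-prime) (≤-trans (s≤s (s≤s 7≤q₂)) (odd<odd⇒2+≤ q₂-odd q₃-odd q₂<q₃))))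
  ≼-compute
  where
  7≤q₂ = ≤-trans (s≤s (s≤s 5≤q₁)) (odd<odd⇒2+≤ q₁-odd q₂-odd q₁<q₂)
... | no 5≰q₁ with refl ← odd<5⇒≡3 (≰⇒> 5≰q₁) (prime≥2 q₁-prime) q₁-odd
  with 7 ≤? q₂
... | yes 7≤q₂ = ≼-trans {y = ratioᶠ 3 ⊗ ratioᶠ 7 ⊗ ratioᶠ 9}
  (⊗³-mono-≼ (geomRatio≼ratioᶠ 3 (suc a₁))
             (geomRatio≼ratioᶠ-≤ (suc a₂) (prime≥2 q₂-prime) 7≤q₂)
             (geomRatio≼ratioᶠ-≤ (suc a₃) (prime≥2 q₃-prime) (≤-trans (s≤s (s≤s 7≤q₂)) (odd<odd⇒2+≤ q₂-odd q₃-odd q₂<q₃))))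
  ≼-compute
... | no 7≰q₂ with refl ← odd<7⇒≡5 (≰⇒> 7≰q₂) (odd<odd⇒2+≤ q₁-odd q₂-odd q₁<q₂) q₂-odd
  with 17 ≤? q₃
... | yes 17≤q₃ = ⊗³-mono-≼ (geomRatio≼ratioᶠ 3 (suc a₁)) (geomRatio≼ratioᶠ 5 (suc a₂))
                            (geomRatio≼ratioᶠ-≤ (suc a₃) (prime≥2 q₃-prime) 17≤q₃)
-- σ(q₃) = q₃ + 1 ∣ 2N would put 4, 6 or 7 in N.
... | no 17≰q₃ with oddPrime<17⇒7,11,13 (≰⇒> 17≰q₃) (odd<odd⇒2+≤ q₂-odd q₃-odd q₂<q₃) q₃-prime q₃-odd | a₃
... | inj₁ refl        | zero   = ⊥-elim (N-odd (∣-trans (divides 2 refl) (*-cancelˡ-∣ {m = 4} 2 σ[q₃^a₃]∣2N)))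
... | inj₂ (inj₁ refl) | zero   = ⊥-elim (N-odd (∣-trans (divides 3 refl) (*-cancelˡ-∣ {m = 6} 2 σ[q₃^a₃]∣2N)))
... | inj₂ (inj₂ refl) | zero   = ⊥-elim (
  no-prime-between (from-yes (prime? 7)) (*-cancelˡ-∣ {m = 7} 2 σ[q₃^a₃]∣2N) (from-yes (5 <? 7)) (from-yes (7 <? 13)))
... | inj₁ refl        | suc a₃ = geomRatio-3-5-7 a₁ a₂ a₃ deficient
... | inj₂ (inj₁ refl) | suc a₃ = geomRatio-3-5-11 a₁ a₂ a₃ deficient
... | inj₂ (inj₂ refl) | suc a₃ = geomRatio-3-5-13 a₁ a₂ a₃ deficient

-- Consecutive primes

nextPrime-≤ : ∀ {q r m} → NextPrime q r → q < m → Prime m → r ≤ m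
nextPrime-≤ (_ , _ , no-prime-between) q<m m-prime = ≮⇒≥ λ m<r → no-prime-between _ q<m m<r m-prime

consecutivePrimes-≤ : ∀ {ps} → (∀ i → NextPrime (ps i) (ps (suc i))) →
  ∀ {xs} → AllPairs _<_ xs → All Prime xs → All (ps 0 ≤_) xs →
  Pointwise _≤_ (applyUpTo ps (length xs)) xs
consecutivePrimes-≤ next []                   []                  []               = []
consecutivePrimes-≤ next (x<xs ∷ xs-increasing) (_ ∷ xs-prime) (ps₀≤x ∷ _) =
  ps₀≤x ∷ consecutivePrimes-≤ (next ∘ suc) xs-increasing xs-prime (bounds x<xs xs-prime)
  where
  bounds : ∀ {ys} → All (_ <_) ys → All Prime ys → All (_ ≤_) ys
  bounds []             []                 = []
  bounds (x<y ∷ x<ys) (y-prime ∷ ys-prime) =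
    nextPrime-≤ (next 0) (≤-<-trans ps₀≤x x<y) y-prime ∷ bounds x<ys ys-prime

∏ratioᶠ-∷ʳ : ∀ xs x → ∏ratioᶠ (xs ∷ʳ x) ≡ ∏ratioᶠ xs ⊗ ratioᶠ x
∏ratioᶠ-∷ʳ xs x = cong₂ _,_
  (trans (product-++ xs (x ∷ [])) (cong (product xs *_) (*-identityʳ x)))
  (trans (cong product (map-++ pred xs (x ∷ []))) (trans (product-++ (map pred xs) (pred x ∷ []))
    (cong (product (map pred xs) *_) (*-identityʳ (pred x)))))

-- a / b, with the junk value a / 1 when b = 0.
⟦_⟧ : Frac → ℚᵘ
⟦ a , b ⟧ = mkℚᵘ (+ a) (pred b)

⟦⊗⟧ : ∀ x y → .{{NonZero (proj₂ x)}} → .{{NonZero (proj₂ y)}} → ⟦ x ⊗ y ⟧ ≡ ⟦ x ⟧ ℚᵘ.* ⟦ y ⟧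
⟦⊗⟧ (a , suc b) (c , suc d) = cong₂ mkℚᵘ (ℤ.pos-* a c) refl

ratio≃⟦ratioᶠ⟧ : ∀ q → 2 ≤ q → toℚᵘ (ratio q) ℚᵘ.≃ ⟦ ratioᶠ q ⟧
ratio≃⟦ratioᶠ⟧ (suc (suc m)) _        = ℚ.toℚᵘ-fromℚᵘ (mkℚᵘ (+ suc (suc m)) m)
ratio≃⟦ratioᶠ⟧ 1             (s≤s ())

prodRatio≃⟦∏ratioᶠ⟧ : ∀ ps → (∀ i → Prime (ps i)) → ∀ n → toℚᵘ (prodRatio ps n) ℚᵘ.≃ ⟦ ∏ratioᶠ (applyUpTo ps n) ⟧
prodRatio≃⟦∏ratioᶠ⟧ ps ps-prime zero    = ℚᵘ.≃-refl
prodRatio≃⟦∏ratioᶠ⟧ ps ps-prime (suc n) = begin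
  toℚᵘ (prodRatio ps n ℚ.* ratio (ps n))                  ≈⟨ ℚ.toℚᵘ-homo-* (prodRatio ps n) (ratio (ps n)) ⟩
  toℚᵘ (prodRatio ps n) ℚᵘ.* toℚᵘ (ratio (ps n))          ≈⟨ ℚᵘ.*-cong (prodRatio≃⟦∏ratioᶠ⟧ ps ps-prime n)
                                                                       (ratio≃⟦ratioᶠ⟧ (ps n) (prime≥2 (ps-prime n))) ⟩
  ⟦ ∏ratioᶠ (applyUpTo ps n) ⟧ ℚᵘ.* ⟦ ratioᶠ (ps n) ⟧    ≡⟨ ⟦⊗⟧ (∏ratioᶠ (applyUpTo ps n)) (ratioᶠ (ps n)) ⟨
  ⟦ ∏ratioᶠ (applyUpTo ps n) ⊗ ratioᶠ (ps n) ⟧           ≡⟨ cong ⟦_⟧ (∏ratioᶠ-∷ʳ (applyUpTo ps n) (ps n)) ⟨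
  ⟦ ∏ratioᶠ (applyUpTo ps n ∷ʳ ps n) ⟧                   ≡⟨ cong (⟦_⟧ ∘ ∏ratioᶠ) (applyUpTo-∷ʳ ps n) ⟩
  ⟦ ∏ratioᶠ (applyUpTo ps (suc n)) ⟧                     ∎
  where
  open ℚᵘ.≃-Reasoning
  instance _ = product-pred-primes≢0 (All.applyUpTo⁺₂ ps n ps-prime) ; _ = pred[prime]≢0 (ps-prime n)

≺⇒⟦<⟧ : ∀ {x y} → .{{NonZero (proj₂ x)}} → .{{NonZero (proj₂ y)}} → x ≺ y → ⟦ x ⟧ ℚᵘ.< ⟦ y ⟧
≺⇒⟦<⟧ {a , suc b} {c , suc d} (mk≺ ad<cb) =
  *<* (subst₂ ℤ._<_ (ℤ.pos-* a (suc d)) (ℤ.pos-* c (suc b)) (+<+ ad<cb))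

256/255<prodRatio : ∀ ps → (∀ i → Prime (ps i)) → ∀ n →
  (256 , 255) ≺ ∏ratioᶠ (applyUpTo ps n) → (+ 256) / 255 ℚ.< prodRatio ps n
256/255<prodRatio ps ps-prime n 256/255≺∏ = ℚ.toℚᵘ-cancel-<
  (ℚᵘ.<-respʳ-≃ (ℚᵘ.≃-sym (prodRatio≃⟦∏ratioᶠ⟧ ps ps-prime n))
    (≺⇒⟦<⟧ 256/255≺∏))
  where instance _ = product-pred-primes≢0 (All.applyUpTo⁺₂ ps n ps-prime)

-- Odd perfect numbers

record PrimeFactorsAre (qs : List ℕ) (n : ℕ) : Set where
  field
    primes : All Prime qs
    ∣⇔∈ : ∀ {p} → Prime p → p ∣ n ⇔ p ∈ qs
open PrimeFactorsAre

primeFactors-increasing : ∀ n → AllPairs _<_ (primeFactors n)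
primeFactors-increasing n =
  AllPairs.filter⁺ (λ p → prime? p ×-dec p ∣? n) (AllPairs.applyUpTo⁺₁ id (suc n) (λ i<j _ → i<j))

primeFactors-are : ∀ n → .{{NonZero n}} → PrimeFactorsAre (primeFactors n) n
primeFactors-are n = record
  { primes = All.tabulate (λ p∈ → proj₁ (∈⁻ p∈))
  ; ∣⇔∈ = λ p-prime → mk⇔ (λ p∣n → ∈-filter⁺ P? (∈-upTo⁺ (s≤s (∣⇒≤ p∣n))) (p-prime , p∣n)) (proj₂ ∘ ∈⁻) }
  where
  P? = λ p → prime? p ×-dec p ∣? n
  ∈⁻ : ∀ {p} → p ∈ primeFactors n → Prime p × p ∣ n
  ∈⁻ p∈ = proj₂ (∈-filter⁻ P? {xs = upTo (suc n)} p∈)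

peel : ∀ {q qs n} → .{{NonZero n}} → All (q <_) qs → PrimeFactorsAre (q ∷ qs) n →
  Σ[ v ∈ Valuation q n ] PrimeFactorsAre qs (Valuation.cofactor v)
peel {q} {qs} {n} q<qs (record { primes = q-prime ∷ qs-prime ; ∣⇔∈ = ∣n⇔∈ }) =
  v , record { primes = qs-prime ; ∣⇔∈ = λ p-prime → mk⇔ (∣r⇒∈ p-prime) (∈⇒∣r p-prime) }
  where
  v : Valuation q n
  v = valuation q-prime (from (∣n⇔∈ q-prime) (here refl))
  open ValuationProperties q-prime v
  ∣r⇒∈ : ∀ {p} → Prime p → p ∣ cofactor → p ∈ qs
  ∣r⇒∈ p-prime p∣r with to (∣n⇔∈ p-prime) (∣-trans p∣r cofactor∣n)
  ... | here refl  = ⊥-elim (q∤cofactor p∣r)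
  ... | there p∈qs = p∈qs
  ∈⇒∣r : ∀ {p} → Prime p → p ∈ qs → p ∣ cofactor
  ∈⇒∣r p-prime p∈qs = ∣cofactor p-prime (>⇒≢ (All.lookup q<qs p∈qs)) (from (∣n⇔∈ p-prime) (there p∈qs))

perfect⇒deficient : ∀ {s x t m} → .{{NonZero s}} → s * t ≡ 2 * (x * m) → m < t → ¬ (2 , 1) ≼ (s , x)
perfect⇒deficient {s} {x} {t} {m} st≡2xm m<t (mk≼ 2x≤s*1) = <-irrefl refl (begin-strict
  2 * (x * m)   ≡⟨ *-assoc 2 x m ⟨
  2 * x * m     ≤⟨ *-monoˡ-≤ m (subst (2 * x ≤_) (*-identityʳ s) 2x≤s*1) ⟩
  s * m         <⟨ *-monoʳ-< s m<t ⟩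
  s * t         ≡⟨ st≡2xm ⟩
  2 * (x * m)   ∎)
  where open ≤-Reasoning

perfect⇒256/255≺ : ∀ {s x t m y} → .{{NonZero s}} → .{{NonZero (x * m)}} →
  s * t ≡ 2 * (x * m) → (s , x) ≼ 255/128 → (t , m) ≺ y → (256 , 255) ≺ y
perfect⇒256/255≺ {s} {x} {t} {m} {Q , D} st≡2xm (mk≼ 128s≤255x) (mk≺ tD<Qm) =
  mk≺ (*-cancelʳ-< (x * m) (256 * D) (Q * 255) (begin-strict
    256 * D * (x * m)      ≡⟨ regroup₁ D x m ⟩
    128 * D * (2 * (x * m)) ≡⟨ cong (128 * D *_) st≡2xm ⟨
    128 * D * (s * t)      ≡⟨ regroup₂ D s t ⟩
    s * 128 * (t * D)      <⟨ *-monoʳ-< (s * 128) tD<Qm ⟩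
    s * 128 * (Q * m)      ≤⟨ *-monoˡ-≤ (Q * m) 128s≤255x ⟩
    255 * x * (Q * m)      ≡⟨ regroup₃ x m Q ⟩
    Q * 255 * (x * m)      ∎))
  where
  open ≤-Reasoning
  instance _ = m*n≢0 s 128
  regroup₁ : ∀ D x m → 256 * D * (x * m) ≡ 128 * D * (2 * (x * m))
  regroup₁ = solve-∀
  regroup₂ : ∀ D s t → 128 * D * (s * t) ≡ s * 128 * (t * D)
  regroup₂ = solve-∀
  regroup₃ : ∀ x m Q → 255 * x * (Q * m) ≡ Q * 255 * (x * m)
  regroup₃ = solve-∀

peel³ : ∀ {q₁ q₂ q₃ qs n} → .{{NonZero n}} → AllPairs _<_ (q₁ ∷ q₂ ∷ q₃ ∷ qs) →
  PrimeFactorsAre (q₁ ∷ q₂ ∷ q₃ ∷ qs) n →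
  ∃[ a₁ ] ∃[ a₂ ] ∃[ a₃ ] ∃[ m ]
    abundancy n ≡ geomRatio³ q₁ q₂ q₃ (suc a₁) (suc a₂) (suc a₃) ⊗ abundancy m × PrimeFactorsAre qs m
peel³ {q₁} {q₂} {q₃} {qs} {n} (q₁<q₂∷q₃∷qs ∷ q₂<q₃∷qs ∷ q₃<qs ∷ _) factors =
  V₁.exponent , V₂.exponent , V₃.exponent , V₃.cofactor , split , proj₂ peeled₃
  where
  peeled₁ = peel q₁<q₂∷q₃∷qs factors
  module V₁ = ValuationProperties (All.head (primes factors)) (proj₁ peeled₁)
  peeled₂ = peel q₂<q₃∷qs (proj₂ peeled₁)
  module V₂ = ValuationProperties (All.head (primes (proj₂ peeled₁))) (proj₁ peeled₂)
  peeled₃ = peel q₃<qs (proj₂ peeled₂)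
  module V₃ = ValuationProperties (All.head (primes (proj₂ peeled₂))) (proj₁ peeled₃)
  g₁ g₂ g₃ : Frac
  g₁ = geomRatio q₁ (suc V₁.exponent)
  g₂ = geomRatio q₂ (suc V₂.exponent)
  g₃ = geomRatio q₃ (suc V₃.exponent)
  split : abundancy n ≡ g₁ ⊗ g₂ ⊗ g₃ ⊗ abundancy V₃.cofactor
  split = begin
    abundancy n                              ≡⟨ V₁.abundancy-valuation ⟩
    g₁ ⊗ abundancy V₁.cofactor               ≡⟨ cong (g₁ ⊗_) V₂.abundancy-valuation ⟩
    g₁ ⊗ (g₂ ⊗ abundancy V₂.cofactor)        ≡⟨ cong (λ z → g₁ ⊗ (g₂ ⊗ z)) V₃.abundancy-valuation ⟩
    g₁ ⊗ (g₂ ⊗ (g₃ ⊗ abundancy V₃.cofactor)) ≡⟨ cong (g₁ ⊗_) (⊗-assoc g₂ g₃ _) ⟩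
    g₁ ⊗ (g₂ ⊗ g₃ ⊗ abundancy V₃.cofactor)   ≡⟨ ⊗-assoc g₁ (g₂ ⊗ g₃) _ ⟩
    g₁ ⊗ (g₂ ⊗ g₃) ⊗ abundancy V₃.cofactor   ≡⟨ cong (_⊗ abundancy V₃.cofactor) (⊗-assoc g₁ g₂ g₃) ⟩
    g₁ ⊗ g₂ ⊗ g₃ ⊗ abundancy V₃.cofactor     ∎
    where open ≡-Reasoning

increasing-gap : ∀ {x y z ws w} → AllPairs _<_ (x ∷ y ∷ z ∷ ws) → w ∈ x ∷ y ∷ z ∷ ws → y < w → w < z → ⊥
increasing-gap ((x<y ∷ _) ∷ _)     (here refl)                  y<x _   = <-asym x<y y<x
increasing-gap _                   (there (here refl))          y<y _   = <-irrefl refl y<y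
increasing-gap _                   (there (there (here refl)))  _   z<z = <-irrefl refl z<z
increasing-gap (_ ∷ _ ∷ z<ws ∷ _) (there (there (there w∈ws))) _   w<z = <-asym w<z (All.lookup z<ws w∈ws)

odd⇒≢0 : ∀ {n} → ¬ 2 ∣ n → NonZero n
odd⇒≢0 {zero}  0-odd = ⊥-elim (0-odd (divides 0 refl))
odd⇒≢0 {suc n} _     = _

oddPerfect⇒256/255≺∏ratioᶠ : ∀ {N q₁ q₂ q₃ p qs} → ¬ 2 ∣ N → σ N ≡ 2 * N →
  AllPairs _<_ (q₁ ∷ q₂ ∷ q₃ ∷ p ∷ qs) → PrimeFactorsAre (q₁ ∷ q₂ ∷ q₃ ∷ p ∷ qs) N →
  (256 , 255) ≺ ∏ratioᶠ (p ∷ qs)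
oddPerfect⇒256/255≺∏ratioᶠ {N} {q₁} {q₂} {q₃} {p} {qs} N-odd perfect
  increasing@((q₁<q₂ ∷ _) ∷ (q₂<q₃ ∷ _) ∷ _) factors@record { primes = q₁-prime ∷ q₂-prime ∷ q₃-prime ∷ _ }
  with a₁ , a₂ , a₃ , m , split , factorsₘ ← peel³ {{odd⇒≢0 N-odd}} increasing factors
  = perfect⇒256/255≺ {{s≢0}} {{xm≢0}} sσm≡2xm G≼255/128
      (abundancy≺∏ratioᶠ p qs m (primes factorsₘ) (λ r-prime → to (∣⇔∈ factorsₘ r-prime)))
  where
  instance N≢0 = odd⇒≢0 N-odd
  G : Frac
  G = geomRatio³ q₁ q₂ q₃ (suc a₁) (suc a₂) (suc a₃)
  s x : ℕ
  s = proj₁ G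
  x = proj₂ G
  sσm≡2N : s * σ m ≡ 2 * N
  sσm≡2N = trans (sym (cong proj₁ split)) perfect
  sσm≡2xm : s * σ m ≡ 2 * (x * m)
  sσm≡2xm = trans sσm≡2N (cong (2 *_) (cong proj₂ split))
  xm≢0 : NonZero (x * m)
  xm≢0 = subst NonZero (cong proj₂ split) N≢0
  s≢0 : NonZero s
  s≢0 = m*n≢0⇒m≢0 s {{subst NonZero (sym sσm≡2N) (m*n≢0 2 N)}}
  instance m≢0 = m*n≢0⇒n≢0 x {{xm≢0}}
  ∈⇒∣N : ∀ {r} → r ∈ q₁ ∷ q₂ ∷ q₃ ∷ p ∷ qs → r ∣ N
  ∈⇒∣N r∈ = from (∣⇔∈ factors (All.lookup (primes factors) r∈)) r∈
  odd : ∀ {r} → r ∈ q₁ ∷ q₂ ∷ q₃ ∷ p ∷ qs → ¬ 2 ∣ r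
  odd r∈ 2∣r = N-odd (∣-trans 2∣r (∈⇒∣N r∈))
  p∣m : p ∣ m
  p∣m = from (∣⇔∈ factorsₘ (All.head (primes factorsₘ))) (here refl)
  σ[q₃^a₃]∣2N : geomSum q₃ (suc a₃) ∣ 2 * N
  σ[q₃^a₃]∣2N = ∣-trans (n∣m*n (proj₁ (geomRatio q₁ (suc a₁) ⊗ geomRatio q₂ (suc a₂))))
                        (∣-trans (m∣m*n (σ m)) (∣-reflexive sσm≡2N))
  G≼255/128 : G ≼ 255/128
  G≼255/128 = geomRatio³≼255/128 a₁ a₂ a₃ q₁-prime q₂-prime q₃-prime
    (odd (here refl)) (odd (there (here refl))) (odd (there (there (here refl)))) q₁<q₂ q₂<q₃ N-odd σ[q₃^a₃]∣2N
    (λ r-prime r∣N → increasing-gap increasing (to (∣⇔∈ factors r-prime) r∣N))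
    (perfect⇒deficient {{s≢0}} sσm≡2xm (prime∣⇒<σ (All.head (primes factorsₘ)) p∣m))

fourthSmallest⇒primeFactors≡ : ∀ N {p} → FourthSmallestPrimeFactor N p →
  ∃[ q₁ ] ∃[ q₂ ] ∃[ q₃ ] ∃[ qs ] primeFactors N ≡ q₁ ∷ q₂ ∷ q₃ ∷ p ∷ qs
fourthSmallest⇒primeFactors≡ N fourth with primeFactors N | fourth
... | q₁ ∷ q₂ ∷ q₃ ∷ p ∷ qs | refl = q₁ , q₂ , q₃ , qs , refl

isB-minimal : ∀ {α ps b n} → IsB α ps b → 1 ≤ n → α ℚ.< prodRatio ps n → b ≤ n
isB-minimal (_ , _ , minimal) 1≤n α<∏ = ≮⇒≥ λ n<b → minimal _ 1≤n n<b α<∏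

256/255<prodRatio-length : ∀ {ps} → (∀ i → NextPrime (ps i) (ps (suc i))) → ∀ {p qs} → ps 0 ≡ p →
  AllPairs _<_ (p ∷ qs) → All Prime (p ∷ qs) → (256 , 255) ≺ ∏ratioᶠ (p ∷ qs) →
  (+ 256) / 255 ℚ.< prodRatio ps (length (p ∷ qs))
256/255<prodRatio-length {ps} next {p} {qs} refl increasing@(p<qs ∷ _) primes@(p-prime ∷ _) 256/255≺ =
  256/255<prodRatio ps ps-prime (length (p ∷ qs))
    (≺-≼-trans 256/255≺ (∏ratioᶠ-antitone (consecutivePrimes-≤ next increasing primes (≤-refl ∷ All.map <⇒≤ p<qs))))
  where
  ps-prime : ∀ i → Prime (ps i)
  ps-prime zero    = p-prime
  ps-prime (suc i) = proj₁ (next i)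
  instance
    _ = product-pred-primes≢0 primes
    _ = product-pred-primes≢0 (All.applyUpTo⁺₂ ps (length (p ∷ qs)) ps-prime)

proposition3 : (N : ℕ) → ¬ (2 ∣ N) → σ N ≡ 2 * N →
    (p₄ : ℕ) → FourthSmallestPrimeFactor N p₄ →
    (ps : ℕ → ℕ) → ps 0 ≡ p₄ → (∀ i → NextPrime (ps i) (ps (suc i))) →
    (b : ℕ) → IsB ((+ 256) / 255) ps b →
    ω N ≥ b + 3
proposition3 N N-odd perfect p₄ fourth ps ps₀≡p₄ next b isB
  with q₁ , q₂ , q₃ , qs , primeFactors≡ ← fourthSmallest⇒primeFactors≡ N fourth = begin
    b + 3                 ≤⟨ +-monoˡ-≤ 3 (isB-minimal isB (s≤s z≤n) 256/255<∏) ⟩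
    length (p₄ ∷ qs) + 3  ≡⟨ +-comm (length (p₄ ∷ qs)) 3 ⟩
    3 + length (p₄ ∷ qs)  ≡⟨ cong length primeFactors≡ ⟨
    ω N                   ∎
  where
  open ≤-Reasoning
  increasing : AllPairs _<_ (q₁ ∷ q₂ ∷ q₃ ∷ p₄ ∷ qs)
  increasing = subst (AllPairs _<_) primeFactors≡ (primeFactors-increasing N)
  factors : PrimeFactorsAre (q₁ ∷ q₂ ∷ q₃ ∷ p₄ ∷ qs) N
  factors = subst (λ L → PrimeFactorsAre L N) primeFactors≡ (primeFactors-are N {{odd⇒≢0 N-odd}})
  256/255<∏ : (+ 256) / 255 ℚ.< prodRatio ps (length (p₄ ∷ qs))
  256/255<∏ = 256/255<prodRatio-length next ps₀≡p₄ (AllPairs.drop⁺ 3 increasing) (All.drop⁺ 3 (primes factors))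
    (oddPerfect⇒256/255≺∏ratioᶠ N-odd perfect increasing factors)
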